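{- Every skew fibration between fographs preserves universals: if $f:G\to H$ is a skew fibration (of the underlying graphs) between fographs $G,H$ that preserves labels, then every universal binder $b$ of $G$ is mapped to a universal binder $f(b)$ of $H$.
   Context: A logical cograph is a cograph (no induced four-vertex path) with vertices labelled by variables (binders) or atoms (literals), at least one literal. Scope of a binder: smallest strong module with at least two vertices containing it (module: $M$ with $N(v)\setminus M=N(w)\setminus M$ for $v,w\in M$; strong: every module disjoint from, inside, or containing it). A binder is existential (universal) if it is adjacent to every (no) other vertex of its scope. A fograph is a logical cograph in which every $x$-binder's scope contains a literal and no other $x$-binder. A graph homomorphism $f:G\to H$ is a skew fibration if for every $v\in V(G)$ and edge $wf(v)\in E(H)$ there is $\hat w$ with $\hat wv\in E(G)$ and $f(\hat w)w\notin E(H)$. -}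

module Defs where

open import Level using (0ℓ)
open import Data.Nat using (ℕ)
open import Data.Fin using (Fin)
open import Data.Product using (Σ; ∃; _×_; _,_)
open import Data.Sum using (_⊎_)
open import Relation.Nullary using (¬_)
open import Relation.Binary.PropositionalEquality using (_≡_; _≢_)
open import Function.Bundles using (_⇔_)

record Graph : Set₁ where
  field
    n    : ℕ
    E    : Fin n → Fin n → Set
    sym  : ∀ {v w} → E v w → E w v
    irr  : ∀ {v} → ¬ E v v
open Graph public

VSet : Graph → Set₁
VSet G = Fin (n G) → Set

-- Cograph: no induced four-vertex path a-b-c-d.
-- (Distinctness of a,b,c,d follows from the edge/non-edge pattern and irreflexivity.)
IsCograph : Graph → Set
IsCograph G = ∀ a b c d →
  ¬ (E G a b × E G b c × E G c d × ¬ E G a c × ¬ E G b d × ¬ E G a d)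

IsModule : (G : Graph) → VSet G → Set
IsModule G M = ∀ v w u → M v → M w → ¬ M u → (E G u v ⇔ E G u w)

_⊆_ : {G : Graph} → VSet G → VSet G → Set
_⊆_ {G} M N = ∀ v → M v → N v

Disjoint : {G : Graph} → VSet G → VSet G → Set
Disjoint {G} M N = ∀ v → M v → N v → Data.Empty.⊥
  where import Data.Empty

IsStrongModule : (G : Graph) → VSet G → Set₁
IsStrongModule G M = IsModule G M ×
  (∀ (M' : VSet G) → IsModule G M' →
     Disjoint {G} M' M ⊎ (_⊆_ {G} M' M ⊎ _⊆_ {G} M M'))

AtLeastTwo : (G : Graph) → VSet G → Set
AtLeastTwo G M = Σ (Fin (n G)) λ v → Σ (Fin (n G)) λ w → v ≢ w × M v × M w

IsScope : (G : Graph) → Fin (n G) → VSet G → Set₁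
IsScope G v M = IsStrongModule G M × AtLeastTwo G M × M v ×
  (∀ (M' : VSet G) → IsStrongModule G M' → AtLeastTwo G M' → M' v → _⊆_ {G} M M')

data Label (A : Set) : Set where
  var : ℕ → Label A
  lit : A → Label A

record LogicalCograph (A : Set) : Set₁ where
  field
    graph   : Graph
    cograph : IsCograph graph
    label   : Fin (n graph) → Label A
    someLit : Σ (Fin (n graph)) λ v → Σ A λ a → label v ≡ lit a
open LogicalCograph public

IsBinder : {A : Set} (G : LogicalCograph A) → Fin (n (graph G)) → Set
IsBinder G v = Σ ℕ λ x → label G v ≡ var x

IsLiteral : {A : Set} (G : LogicalCograph A) → Fin (n (graph G)) → Set
IsLiteral G v = Σ _ λ a → label G v ≡ lit a

IsUniversal : {A : Set} (G : LogicalCograph A) → Fin (n (graph G)) → Set₁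
IsUniversal G b = IsBinder G b ×
  Σ (VSet (graph G)) λ M → IsScope (graph G) b M ×
    (∀ w → M w → w ≢ b → ¬ E (graph G) b w)

IsFograph : {A : Set} → LogicalCograph A → Set₁
IsFograph G = ∀ b x → label G b ≡ var x → ∀ M → IsScope (graph G) b M →
  (Σ (Fin (n (graph G))) λ w → M w × IsLiteral G w) ×
  (∀ w → M w → label G w ≡ var x → w ≡ b)

IsHom : (G H : Graph) → (Fin (n G) → Fin (n H)) → Set
IsHom G H f = ∀ v w → E G v w → E H (f v) (f w)

IsSkewFibration : (G H : Graph) → (Fin (n G) → Fin (n H)) → Set
IsSkewFibration G H f = IsHom G H f ×
  (∀ v w → E H w (f v) →
     Σ (Fin (n G)) λ ŵ → E G ŵ v × ¬ E H (f ŵ) w)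

module Submission where

-- Let b be universal in G with scope M, and put x = f b.  The candidate scope
-- of x in H is the set  Dominators x  of non-neighbours y of x with
-- N(x) ⊆ N(y).  Modules are arbitrary predicates,
--    so comparing a strong module M with the constant module λ _ → Q decides
--    Q whenever M is proper; comparing M with singletons decides membership
--    in M.  Hence either M is the whole graph (then b, and so x, is isolated)
--    or excluded middle holds.  Dominators x is a strong module (a P4-free
--    argument), and a module of non-neighbours of x containing x lies in every
--    strong module with two vertices containing x; so Dominators x is the
--    scope of x as soon as it has a second element.
--  * Skew fibrations.  A second vertex l of M has the same neighbours as b
--    (they are all outside M), and lifting edges at x shows that f l is a
--    dominator of x; it differs from x because the fograph G has no second
--    binder of b's variable in M.

open import Defs
open import Level using (0ℓ)
open import Axiom.ExcludedMiddle using (ExcludedMiddle)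
open import Axiom.DoubleNegationElimination using (em⇒dne)
open import Data.Fin using (Fin; _≟_)
open import Data.Fin.Properties using (all?; ¬∀⟶∃¬)
open import Data.Product using (Σ; _×_; _,_; proj₁; proj₂)
open import Data.Sum using (_⊎_; inj₁; inj₂; map₁)
open import Data.Empty using (⊥-elim)
open import Relation.Nullary using (¬_; Dec; yes; no)
open import Relation.Binary.PropositionalEquality
  using (_≡_; _≢_; refl; trans; cong; module ≡-Reasoning)
  renaming (sym to ≡-sym)
open import Function.Bundles using (mk⇔; module Equivalence)
open Equivalence using (to; from)

constantModule : (G : Graph) (Q : Set) → IsModule G (λ _ → Q)
constantModule G Q v w u q _ ¬q = ⊥-elim (¬q q)

singletonModule : (G : Graph) (u : Fin (n G)) → IsModule G (λ v → v ≡ u)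
singletonModule G u v w _ refl refl _ = mk⇔ (λ e → e) (λ e → e)

-- Comparing a proper nonempty strong module with the constant module Q decides Q.
properStrong⇒EM : (G : Graph) {M : VSet G} → IsStrongModule G M →
  ∀ {v u} → M v → ¬ M u → ExcludedMiddle 0ℓ
properStrong⇒EM G (_ , strong) {v} {u} Mv ¬Mu {Q}
  with strong (λ _ → Q) (constantModule G Q)
... | inj₁ disjoint      = no (λ q → disjoint v q Mv)
... | inj₂ (inj₁ Q⊆M)   = no (λ q → ¬Mu (Q⊆M u q))
... | inj₂ (inj₂ M⊆Q)   = yes (M⊆Q v Mv)

-- Comparing a strong module with two vertices with the singleton {u} decides u ∈ M.
strongMembership? : (G : Graph) {M : VSet G} → IsStrongModule G M →
  AtLeastTwo G M → ∀ u → Dec (M u)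
strongMembership? G (_ , strong) (v , w , v≢w , Mv , Mw) u
  with strong (λ v → v ≡ u) (singletonModule G u)
... | inj₁ disjoint      = no (disjoint u refl)
... | inj₂ (inj₁ u∈M)   = yes (u∈M u refl)
... | inj₂ (inj₂ M⊆u)   = ⊥-elim (v≢w (trans (M⊆u v Mv) (≡-sym (M⊆u w Mw))))

strongFullOrEM : (G : Graph) {M : VSet G} → IsStrongModule G M → AtLeastTwo G M →
  (∀ v → M v) ⊎ ExcludedMiddle 0ℓ
strongFullOrEM G strongM twoM@(_ , _ , _ , Mv , _) with all? (strongMembership? G strongM twoM)
... | yes full = inj₁ full
... | no ¬full with ¬∀⟶∃¬ _ _ (strongMembership? G strongM twoM) ¬full
...   | (u , ¬Mu) = inj₂ (properStrong⇒EM G strongM Mv ¬Mu)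

fullStrong : (G : Graph) {M : VSet G} → (∀ v → M v) → IsStrongModule G M
fullStrong G full =
  (λ _ _ u _ _ ¬Mu → ⊥-elim (¬Mu (full u))) , λ _ _ → inj₂ (inj₁ (λ v _ → full v))

anotherMember : (G : Graph) {M : VSet G} → AtLeastTwo G M →
  ∀ x → Σ (Fin (n G)) λ y → M y × y ≢ x
anotherMember G (v , w , v≢w , Mv , Mw) x with v ≟ x
... | yes refl = w , Mw , λ w≡v → v≢w (≡-sym w≡v)
... | no v≢x   = v , Mv , v≢x

-- Removing x from a module of non-neighbours of x leaves a module:
-- x itself sees none of its members.
withoutModule : (G : Graph) {N : VSet G} (x : Fin (n G)) → IsModule G N →
  (∀ y → N y → ¬ E G x y) → IsModule G (λ y → N y × y ≢ x)
withoutModule G x modN nonadj v w u (Nv , _) (Nw , _) ¬Ku with u ≟ x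
... | yes refl = mk⇔ (λ e → ⊥-elim (nonadj v Nv e)) (λ e → ⊥-elim (nonadj w Nw e))
... | no u≢x   = modN v w u Nv Nw (λ Nu → ¬Ku (Nu , u≢x))

-- Otherwise M' ⊆ N, and then M'
-- can neither avoid N ∖ {x} (it has a member y ≠ x) nor lie inside it (x ∈ M'),
-- so N ∖ {x} ⊆ M' and hence N ⊆ M' after all.
nonadjacentModuleMinimal : (G : Graph) {N : VSet G} {x : Fin (n G)} → IsModule G N →
  N x → (∀ y → N y → ¬ E G x y) →
  ∀ M' → IsStrongModule G M' → AtLeastTwo G M' → M' x → _⊆_ {G} N M'
nonadjacentModuleMinimal G {N} {x} modN Nx nonadj M' (_ , strong') two' M'x
  with strong' N modN
... | inj₁ disjoint    = ⊥-elim (disjoint x Nx M'x)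
... | inj₂ (inj₁ N⊆M') = N⊆M'
... | inj₂ (inj₂ M'⊆N)
  with strong' (λ y → N y × y ≢ x) (withoutModule G x modN nonadj)
...   | inj₁ disjoint    = let (y , M'y , y≢x) = anotherMember G two' x
                           in ⊥-elim (disjoint y (M'⊆N y M'y , y≢x) M'y)
...   | inj₂ (inj₂ M'⊆K) = ⊥-elim (proj₂ (M'⊆K x M'x) refl)
...   | inj₂ (inj₁ K⊆M') = N⊆M'
  where
  N⊆M' : _⊆_ {G} N M'
  N⊆M' v Nv with v ≟ x
  ... | yes refl = M'x
  ... | no v≢x   = K⊆M' v (Nv , v≢x)

Isolated : (G : Graph) → Fin (n G) → Set
Isolated G x = ∀ z → ¬ E G x z

Dominators : (G : Graph) → Fin (n G) → VSet G
Dominators G x y = ¬ E G x y × (∀ z → E G x z → E G y z)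

dominatorsSelf : (G : Graph) (x : Fin (n G)) → Dominators G x x
dominatorsSelf G x = irr G , λ _ e → e

isolatedDominators : (G : Graph) {x : Fin (n G)} → Isolated G x → ∀ y → Dominators G x y
isolatedDominators G iso y = iso y , λ z e → ⊥-elim (iso z e)

module _ (em : ExcludedMiddle 0ℓ) (G : Graph) (cog : IsCograph G) (x : Fin (n G)) where

  private
    D : VSet G
    D = Dominators G x

  outsideDominators : ∀ u → ¬ D u →
    E G x u ⊎ (¬ E G x u × Σ (Fin (n G)) λ z → E G x z × ¬ E G u z)
  outsideDominators u ¬Du with em {E G x u}
  ... | yes exu = inj₁ exu
  ... | no ¬exu with em {Σ (Fin (n G)) λ z → E G x z × ¬ E G u z}
  ...   | yes missed = inj₂ (¬exu , missed)
  ...   | no none    =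
    ⊥-elim (¬Du (¬exu , λ z exz → em⇒dne em (λ ¬euz → none (z , exz , ¬euz))))

  -- A non-dominator u adjacent to a dominator v is adjacent to every dominator w:
  -- if u is not a neighbour of x, the vertices u - v - z - x form an induced P4.
  dominatorsModule : IsModule G D
  dominatorsModule _ _ u Dv Dw ¬Du = mk⇔ (adjacent Dv Dw) (adjacent Dw Dv)
    where
    adjacent : ∀ {v w} → D v → D w → E G u v → E G u w
    adjacent {v} (¬exv , domv) (_ , domw) euv with outsideDominators u ¬Du
    ... | inj₁ exu = sym G (domw u exu)
    ... | inj₂ (¬exu , z , exz , ¬euz) = ⊥-elim (cog u v z x
      (euv , domv z exz , sym G exz , ¬euz , (λ e → ¬exv (sym G e)) , λ e → ¬exu (sym G e)))

  -- A module M' containing x and a non-dominator d contains every dominator c: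
  -- otherwise c would distinguish x from d, or x from a neighbour z of x missed by d.
  moduleAbsorbsDominators : ∀ {M'} → IsModule G M' → ∀ {d} → M' d → ¬ D d → M' x →
    ∀ c → D c → ¬ ¬ M' c
  moduleAbsorbsDominators {M'} modM' M'd ¬Dd M'x c (¬exc , domc) ¬M'c
    with outsideDominators _ ¬Dd
  ... | inj₁ exd = ¬exc (sym G (from (modM' x _ c M'x M'd ¬M'c) (domc _ exd)))
  ... | inj₂ (_ , z , exz , ¬edz) with em {M' z}
  ...   | yes M'z = ¬exc (sym G (to (modM' z x c M'z M'x ¬M'c) (domc z exz)))
  ...   | no ¬M'z = ¬edz (sym G (to (modM' x _ z M'x M'd ¬M'z) (sym G exz)))

  -- A module M' containing a non-dominator d but not x contains no dominator a:
  -- x, or a neighbour z of x missed by d, would distinguish a from d.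
  moduleAvoidsDominators : ∀ {M'} → IsModule G M' → ∀ {d} → M' d → ¬ D d → ¬ M' x →
    ∀ a → M' a → ¬ D a
  moduleAvoidsDominators {M'} modM' M'd ¬Dd ¬M'x a M'a (¬exa , doma)
    with outsideDominators _ ¬Dd
  ... | inj₁ exd = ¬exa (from (modM' a _ x M'a M'd ¬M'x) exd)
  ... | inj₂ (_ , z , exz , ¬edz) with em {M' z}
  ...   | yes M'z = ¬exa (to (modM' z a x M'z M'a ¬M'x) exz)
  ...   | no ¬M'z = ¬edz (sym G (to (modM' a _ z M'a M'd ¬M'z) (sym G (doma z exz))))

  -- Any module M' lies inside D, or contains a non-dominator d; by the two
  -- lemmas above it then contains D or avoids it, according as x ∈ M' or not.
  dominatorsStrongEM : IsStrongModule G D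
  dominatorsStrongEM = dominatorsModule , compare
    where
    compare : ∀ M' → IsModule G M' → Disjoint {G} M' D ⊎ (_⊆_ {G} M' D ⊎ _⊆_ {G} D M')
    compare M' modM' with em {Σ (Fin (n G)) λ d → M' d × ¬ D d}
    ... | no none = inj₂ (inj₁ λ v M'v → em⇒dne em (λ ¬Dv → none (v , M'v , ¬Dv)))
    ... | yes (d , M'd , ¬Dd) with em {M' x}
    ...   | yes M'x = inj₂ (inj₂ λ c Dc →
                        em⇒dne em (moduleAbsorbsDominators modM' M'd ¬Dd M'x c Dc))
    ...   | no ¬M'x = inj₁ (moduleAvoidsDominators modM' M'd ¬Dd ¬M'x)

-- The hypothesis under which Dominators x behaves well: x is isolated, or
-- excluded middle holds.
Tame : (G : Graph) → Fin (n G) → Set₁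
Tame G x = Isolated G x ⊎ ExcludedMiddle 0ℓ

dominatorFromStable : (G : Graph) {x y : Fin (n G)} → Tame G x → ¬ E G x y →
  (∀ z → E G x z → ¬ ¬ E G y z) → Dominators G x y
dominatorFromStable G {y = y} (inj₁ iso) _ _ = isolatedDominators G iso y
dominatorFromStable G (inj₂ em) ¬exy dom = ¬exy , λ z exz → em⇒dne em (dom z exz)

dominatorsStrong : (G : Graph) {x : Fin (n G)} → IsCograph G → Tame G x →
  IsStrongModule G (Dominators G x)
dominatorsStrong G _ (inj₁ iso)      = fullStrong G (isolatedDominators G iso)
dominatorsStrong G {x} cog (inj₂ em) = dominatorsStrongEM em G cog x

dominatorsScope : (G : Graph) {x y : Fin (n G)} → IsCograph G → Tame G x →
  Dominators G x y → y ≢ x → IsScope G x (Dominators G x)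
dominatorsScope G {x} {y} cog tame Dy y≢x =
  strongD , (x , y , (λ x≡y → y≢x (≡-sym x≡y)) , dominatorsSelf G x , Dy) ,
  dominatorsSelf G x ,
  nonadjacentModuleMinimal G (proj₁ strongD) (dominatorsSelf G x) (λ _ → proj₁)
  where
  strongD : IsStrongModule G (Dominators G x)
  strongD = dominatorsStrong G cog tame

module _ (G H : Graph) {f : Fin (n G) → Fin (n H)} (skew : IsSkewFibration G H f) where

  private
    hom : IsHom G H f
    hom = proj₁ skew

    lift : ∀ v w → E H w (f v) → Σ (Fin (n G)) λ ŵ → E G ŵ v × ¬ E H (f ŵ) w
    lift = proj₂ skew

  -- An edge at f b lifts to an edge at b, so isolated vertices have isolated images.
  isolatedImage : ∀ {b} → Isolated G b → Isolated H (f b)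
  isolatedImage {b} iso z e with lift b z (sym H e)
  ... | (ŵ , eŵb , _) = iso ŵ (sym G eŵb)

  module _ {M : VSet G} (modM : IsModule G M) {b l : Fin (n G)} (Mb : M b) (Ml : M l)
           (outsideM : ∀ w → E G w b → ¬ M w) where

    sharedNeighbour : ∀ w → E G w b → E H (f w) (f l)
    sharedNeighbour w ewb = hom w l (to (modM b l w Mb Ml (outsideM w ewb)) ewb)

    -- An edge f b — f l would lift to a neighbour of b whose image misses f l.
    twinImageNonadjacent : ¬ E H (f b) (f l)
    twinImageNonadjacent e with lift b (f l) (sym H e)
    ... | (ŵ , eŵb , ¬eŵl) = ¬eŵl (sharedNeighbour ŵ eŵb)

    -- For a neighbour z of f b, lift to ŵ; if f l missed z then
    -- z - f b - f ŵ - f l would be an induced P4.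
    twinImageDominates : IsCograph H → ∀ z → E H (f b) z → ¬ ¬ E H (f l) z
    twinImageDominates cogH z ebz ¬elz with lift b z (sym H ebz)
    ... | (ŵ , eŵb , ¬eŵz) = cogH z (f b) (f ŵ) (f l)
      (sym H ebz , sym H (hom ŵ b eŵb) , sharedNeighbour ŵ eŵb ,
       (λ e → ¬eŵz (sym H e)) , twinImageNonadjacent , λ e → ¬elz (sym H e))

neighboursOutside : (G : Graph) {M : VSet G} {b : Fin (n G)} →
  (∀ w → M w → w ≢ b → ¬ E G b w) → ∀ w → E G w b → ¬ M w
neighboursOutside G noadj w ewb Mw = noadj w Mw (λ { refl → irr G ewb }) (sym G ewb)

fullNonadjacentIsolated : (G : Graph) {M : VSet G} {b : Fin (n G)} →
  (∀ w → M w → w ≢ b → ¬ E G b w) → (∀ w → M w) → Isolated G b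
fullNonadjacentIsolated G {b = b} noadj full w with w ≟ b
... | yes refl = irr G
... | no w≢b   = noadj w (full w) w≢b

-- In a fograph, a label-preserving map cannot identify a binder b with
-- another vertex l of its scope, which would carry the same variable.
scopeImageDistinct : {A : Set} (G H : LogicalCograph A) → IsFograph G →
  (f : Fin (n (graph G)) → Fin (n (graph H))) → (∀ v → label H (f v) ≡ label G v) →
  ∀ {b x M l} → label G b ≡ var x → IsScope (graph G) b M → M l → l ≢ b → f l ≢ f b
scopeImageDistinct G H fogG f lab {b} {x} {M} {l} bx scope Ml l≢b fl≡fb =
  l≢b (proj₂ (fogG b x bx M scope) l Ml lx)
  where
  open ≡-Reasoning
  lx : label G l ≡ var x
  lx = begin
    label G l      ≡⟨ ≡-sym (lab l) ⟩
    label H (f l)  ≡⟨ cong (label H) fl≡fb ⟩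
    label H (f b)  ≡⟨ lab b ⟩
    label G b      ≡⟨ bx ⟩
    var x          ∎

mainTheorem14 : {A : Set} (G H : LogicalCograph A) →
    IsFograph G → IsFograph H →
    (f : Fin (n (graph G)) → Fin (n (graph H))) →
    IsSkewFibration (graph G) (graph H) f →
    (∀ v → label H (f v) ≡ label G v) →
    ∀ b → IsUniversal G b → IsUniversal H (f b)
mainTheorem14 G H fogG _ f skew lab b
  ((x , bx) , M , scope@((modM , _) , twoM , Mb , _) , noadj)
  with anotherMember (graph G) twoM b
... | (l , Ml , l≢b) =
  (x , trans (lab b) bx) , Dominators (graph H) (f b) ,
  dominatorsScope (graph H) (cograph H) tame dominator
    (scopeImageDistinct G H fogG f lab bx scope Ml l≢b) ,
  λ _ Dw _ → proj₁ Dw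
  where
  -- b is isolated (then so is f b), or its proper scope yields excluded middle.
  tame : Tame (graph H) (f b)
  tame = map₁ (λ full → isolatedImage (graph G) (graph H) skew
                          (fullNonadjacentIsolated (graph G) noadj full))
              (strongFullOrEM (graph G) (proj₁ scope) twoM)
  outside : ∀ w → E (graph G) w b → ¬ M w
  outside = neighboursOutside (graph G) noadj
  dominator : Dominators (graph H) (f b) (f l)
  dominator = dominatorFromStable (graph H) tame
    (twinImageNonadjacent (graph G) (graph H) skew modM Mb Ml outside)
    (twinImageDominates (graph G) (graph H) skew modM Mb Ml outside (cograph H))
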